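{- Let $(\mathcal{P},\mathcal{M})$ be an abstract light dual multinet labeled by the quasigroup $(Q,\cdot)$ with labeling bijections $\alpha_i:Q\to\mathcal{P}_i$ ($i=1,2,3$), and let $B\in\mathcal{M}$. Put $S_i=\{x\in Q\mid \alpha_i(x)\in B\}$ for $i=1,2,3$. Then $(S_1,S_2,S_3)$ is a subsquare of $Q$.
   Context: A quasigroup $(Q,\cdot)$ is a set with a binary operation such that $x\cdot y=z$ is uniquely solvable for any one of $x,y,z$ given the other two; the solutions are written $y=x\backslash z$, $x=z/y$. For subsets $S_1,S_2,S_3\subseteq Q$, the triple $(S_1,S_2,S_3)$ is a subsquare of $Q$ if $S_1\cdot S_2\subseteq S_3$, $S_1\backslash S_3\subseteq S_2$ and $S_3/S_2\subseteq S_1$ (elementwise products/divisions). An abstract light dual multinet labeled by $Q$ is a pair $(\mathcal{P},\mathcal{M})$ such that: (1) $\mathcal{P}$ is the disjoint union of $\mathcal{P}_1,\mathcal{P}_2,\mathcal{P}_3$; (2) $\mathcal{M}$ is a set of subsets of $\mathcal{P}$ (blocks) such that any two points of $\mathcal{P}$ lie in at most one element of $\mathcal{M}$; (3) there are bijections $\alpha_i:Q\to\mathcal{P}_i$ such that for all $x,y\in Q$ some element of $\mathcal{M}$ contains $\alpha_1(x),\alpha_2(y),\alpha_3(x\cdot y)$; (4) $|\mathcal{M}|>1$. -}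

module Defs where

open import Level using (Level; _⊔_; suc)
open import Data.Product using (Σ; _×_; _,_; ∃)
open import Data.Sum using (_⊎_; inj₁; inj₂)
open import Relation.Binary.PropositionalEquality using (_≡_)
open import Relation.Nullary using (¬_)
open import Relation.Unary using (Pred; _∈_; _≐_)
open import Function.Bundles using (_⤖_; Bijection)
open import Algebra.Core using (Op₂)
open import Algebra.Structures using (IsQuasigroup)

record QuasigroupOn (Q : Set) : Set where
  field
    _·_  : Op₂ Q
    _\\_ : Op₂ Q
    _//_ : Op₂ Q
    isQuasigroup : IsQuasigroup _≡_ _·_ _\\_ _//_

record IsSubsquare {Q : Set} (G : QuasigroupOn Q) {ℓ : Level}
                   (S₁ S₂ S₃ : Pred Q ℓ) : Set ℓ where
  open QuasigroupOn G
  field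
    mul  : ∀ x y → x ∈ S₁ → y ∈ S₂ → (x · y) ∈ S₃
    ldiv : ∀ x z → x ∈ S₁ → z ∈ S₃ → (x \\ z) ∈ S₂
    rdiv : ∀ z y → z ∈ S₃ → y ∈ S₂ → (z // y) ∈ S₁

Points : (P₁ P₂ P₃ : Set) → Set
Points P₁ P₂ P₃ = P₁ ⊎ (P₂ ⊎ P₃)

ι₁ : ∀ {P₁ P₂ P₃ : Set} → P₁ → Points P₁ P₂ P₃
ι₁ = inj₁
ι₂ : ∀ {P₁ P₂ P₃ : Set} → P₂ → Points P₁ P₂ P₃
ι₂ p = inj₂ (inj₁ p)
ι₃ : ∀ {P₁ P₂ P₃ : Set} → P₃ → Points P₁ P₂ P₃
ι₃ p = inj₂ (inj₂ p)

-- Abstract light dual multinet labeled by the quasigroup G, with point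
-- classes P₁ P₂ P₃, block family M (a set of subsets of 𝒫; subsets are
-- predicates, and equality of blocks is extensional equality ≐), and
-- labeling bijections α₁ α₂ α₃.
record IsLightDualMultinet {Q : Set} (G : QuasigroupOn Q) {ℓ ℓ' : Level}
    (P₁ P₂ P₃ : Set)
    (M : Pred (Pred (Points P₁ P₂ P₃) ℓ) ℓ')
    (α₁ : Q ⤖ P₁) (α₂ : Q ⤖ P₂) (α₃ : Q ⤖ P₃) : Set (suc ℓ ⊔ ℓ') where
  open QuasigroupOn G
  field
    atMostOne : ∀ (p q : Points P₁ P₂ P₃) → ¬ (p ≡ q) →
                ∀ (B B' : Pred (Points P₁ P₂ P₃) ℓ) → B ∈ M → B' ∈ M →
                p ∈ B → q ∈ B → p ∈ B' → q ∈ B' → B ≐ B'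
    collinear : ∀ (x y : Q) → Σ (Pred (Points P₁ P₂ P₃) ℓ) λ B → B ∈ M ×
                (ι₁ (Bijection.to α₁ x) ∈ B × ι₂ (Bijection.to α₂ y) ∈ B
                  × ι₃ (Bijection.to α₃ (x · y)) ∈ B)
    moreThanOne : Σ (Pred (Points P₁ P₂ P₃) ℓ) λ B → Σ (Pred (Points P₁ P₂ P₃) ℓ) λ B' →
                  B ∈ M × B' ∈ M × ¬ (B ≐ B')

module Submission where

-- Fix a block B of the dual multinet.  By axiom (3), for all
-- x, y the three points α₁(x), α₂(y), α₃(x·y) lie on a common block B';
-- since points of different classes are distinct, axiom (2) forces B' = B
-- as soon as B contains two of these three points.  Hence B contains any
-- two of α₁(x), α₂(y), α₃(x·y) only together with the third
-- ("triangle completion").  The three subsquare conditions are exactly the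
-- three instances of this, where for the division conditions we choose
-- y = x \\ z (resp. x = z // y) and use x·(x\\z) = z (resp. (z//y)·y = z).

open import Defs
open import Level using (Level)
open import Relation.Unary using (Pred; _∈_)
open import Function.Bundles using (_⤖_; Bijection)
open import Data.Product using (_,_; proj₁; proj₂)
open import Relation.Binary.PropositionalEquality using (_≡_; _≢_; sym; subst)
open import Algebra.Structures using (IsQuasigroup)

module _ {ℓ ℓ' : Level} {Q : Set} {G : QuasigroupOn Q} {P₁ P₂ P₃ : Set}
         {M : Pred (Pred (Points P₁ P₂ P₃) ℓ) ℓ'}
         {α₁ : Q ⤖ P₁} {α₂ : Q ⤖ P₂} {α₃ : Q ⤖ P₃}
         (net : IsLightDualMultinet G P₁ P₂ P₃ M α₁ α₂ α₃) where

  open QuasigroupOn G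
  open IsLightDualMultinet net

  a₁ a₂ a₃ : Q → Points P₁ P₂ P₃
  a₁ x = ι₁ (Bijection.to α₁ x)
  a₂ y = ι₂ (Bijection.to α₂ y)
  a₃ z = ι₃ (Bijection.to α₃ z)

  sharedPair⇒⊆ : ∀ {p q r} {B B′} → p ≢ q → B ∈ M → B′ ∈ M →
                 p ∈ B → q ∈ B → p ∈ B′ → q ∈ B′ → r ∈ B′ → r ∈ B
  sharedPair⇒⊆ {p} {q} {B = B} {B′} p≢q B∈M B′∈M p∈B q∈B p∈B′ q∈B′ =
    proj₂ (atMostOne p q p≢q B B′ B∈M B′∈M p∈B q∈B p∈B′ q∈B′)

  -- The block B′ through all
  -- three comes from axiom (3); the two shared points are distinct because
  -- they lie in different classes, which the absurd pattern (λ ()) records.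
  complete₃ : ∀ {B} x y → B ∈ M → a₁ x ∈ B → a₂ y ∈ B → a₃ (x · y) ∈ B
  complete₃ x y B∈M x∈B y∈B with collinear x y
  ... | B′ , B′∈M , x∈B′ , y∈B′ , xy∈B′ =
    sharedPair⇒⊆ (λ ()) B∈M B′∈M x∈B y∈B x∈B′ y∈B′ xy∈B′

  complete₂ : ∀ {B} x y → B ∈ M → a₁ x ∈ B → a₃ (x · y) ∈ B → a₂ y ∈ B
  complete₂ x y B∈M x∈B xy∈B with collinear x y
  ... | B′ , B′∈M , x∈B′ , y∈B′ , xy∈B′ =
    sharedPair⇒⊆ (λ ()) B∈M B′∈M x∈B xy∈B x∈B′ xy∈B′ y∈B′

  complete₁ : ∀ {B} x y → B ∈ M → a₂ y ∈ B → a₃ (x · y) ∈ B → a₁ x ∈ B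
  complete₁ x y B∈M y∈B xy∈B with collinear x y
  ... | B′ , B′∈M , x∈B′ , y∈B′ , xy∈B′ =
    sharedPair⇒⊆ (λ ()) B∈M B′∈M y∈B xy∈B y∈B′ xy∈B′ x∈B′

  a₃-cong : ∀ {B : Pred (Points P₁ P₂ P₃) ℓ} {z w} → z ≡ w → a₃ w ∈ B → a₃ z ∈ B
  a₃-cong {B} z≡w = subst (λ v → a₃ v ∈ B) (sym z≡w)

lemma3p2 : ∀ {ℓ ℓ' : Level} {Q : Set} (G : QuasigroupOn Q) (P₁ P₂ P₃ : Set)
             (M : Pred (Pred (Points P₁ P₂ P₃) ℓ) ℓ')
             (α₁ : Q ⤖ P₁) (α₂ : Q ⤖ P₂) (α₃ : Q ⤖ P₃) →
             IsLightDualMultinet G P₁ P₂ P₃ M α₁ α₂ α₃ →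
             (B : Pred (Points P₁ P₂ P₃) ℓ) → B ∈ M →
             IsSubsquare G (λ x → ι₁ {P₁} {P₂} {P₃} (Bijection.to α₁ x) ∈ B)
                           (λ x → ι₂ {P₁} {P₂} {P₃} (Bijection.to α₂ x) ∈ B)
                           (λ x → ι₃ {P₁} {P₂} {P₃} (Bijection.to α₃ x) ∈ B)
lemma3p2 G P₁ P₂ P₃ M α₁ α₂ α₃ net B B∈M = record
  { mul  = λ x y x∈B y∈B → complete₃ net x y B∈M x∈B y∈B
  -- x \\ z ∈ S₂ because x · (x \\ z) = z ∈ S₃
  ; ldiv = λ x z x∈B z∈B →
      complete₂ net x (x \\ z) B∈M x∈B (a₃-cong net {B} (proj₁ leftDivides x z) z∈B)
  -- z // y ∈ S₁ because (z // y) · y = z ∈ S₃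
  ; rdiv = λ z y z∈B y∈B →
      complete₁ net (z // y) y B∈M y∈B (a₃-cong net {B} (proj₁ rightDivides y z) z∈B)
  }
  where
  open QuasigroupOn G
  open IsQuasigroup isQuasigroup using (leftDivides; rightDivides)
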